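{- Let $G$ be a balanced graph with $m$ edges on the vertex set $[n]$. Then $m\le\tau(G,n)\le\tau_{\text{lab}}(G,n)\le\lceil m/n\rceil n$. In particular, if $m/n$ is an integer, then $\tau(G,n)=\tau_{\text{lab}}(G,n)=m$.
   Context: A graph $G$ is balanced if $e(G)/v(G)=\max\{e(H)/v(H):\emptyset\ne H\subseteq G\}$. Semi-random no-replacement multigraph process on $[n]=\{1,\dots,n\}$: let $\pi_1,\pi_2,\dots$ be independent uniformly random permutations in $S_n$. Builder's multigraph starts empty on $[n]$. In round $k\ge1$ Builder is offered the vertex $v_k:=\pi_{\lceil k/n\rceil}(k-\lfloor (k-1)/n\rfloor n)$; Builder then chooses a vertex $u_k$ according to his strategy (a rule depending on the history so far) and adds the edge $u_kv_k$ (multiple edges allowed). For a labeled graph $G$ on $[n]$ and a strategy $\mathcal S$, let $\tau(\mathcal S)$ be the least $m$ such that Builder's multigraph after $m$ rounds contains $G$ (resp. some graph isomorphic to $G$) as a subgraph; $\tau_{\text{lab}}(G,n)$ (resp. $\tau(G,n)$) is a random variable with $\Pr(\cdot\le k)=\max_{\mathcal S}\Pr(\tau(\mathcal S)\le k)$ for all $k\ge0$, coupled so that $\tau(G,n)\le\tau_{\text{lab}}(G,n)$. -}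

module Defs where

open import Data.Nat using (ℕ; zero; suc; _+_; _*_; _∸_; _≤_; _<_; NonZero)
open import Data.Nat.DivMod using (_/_; _%_; m%n<n)
open import Data.Bool using (Bool; true; false; if_then_else_; _∧_)
open import Data.Nat using (_<ᵇ_)
open import Data.Fin using (Fin; toℕ; fromℕ<)
open import Data.Fin.Permutation using (Permutation′; _⟨$⟩ʳ_)
open import Data.List using (List; []; _∷_; _++_; [_]; map; upTo; allFin)
open import Data.Nat.ListAction using (sum)
open import Data.List.Membership.Propositional using (_∈_)
open import Data.Product using (_×_; _,_; Σ)
open import Data.Sum using (_⊎_)
open import Relation.Binary.PropositionalEquality using (_≡_)
open import Function.Definitions using (Injective)

record SimpleGraph (n : ℕ) : Set where
  field
    adj    : Fin n → Fin n → Bool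
    sym    : ∀ i j → adj i j ≡ adj j i
    irrefl : ∀ i → adj i i ≡ false
open SimpleGraph public

countV : ∀ {n} → (Fin n → Bool) → ℕ
countV {n} p = sum (map (λ i → if p i then 1 else 0) (allFin n))

countE : ∀ {n} → (Fin n → Fin n → Bool) → ℕ
countE {n} a = sum (map (λ i → sum (map (λ j →
  if (toℕ i <ᵇ toℕ j) ∧ a i j then 1 else 0) (allFin n))) (allFin n))

edgeCount : ∀ {n} → SimpleGraph n → ℕ
edgeCount G = countE (adj G)

record Subgraph {n : ℕ} (G : SimpleGraph n) : Set where
  field
    verts  : Fin n → Bool
    eadj   : Fin n → Fin n → Bool
    esym   : ∀ i j → eadj i j ≡ eadj j i
    sub    : ∀ i j → eadj i j ≡ true → adj G i j ≡ true
    endsˡ  : ∀ i j → eadj i j ≡ true → verts i ≡ true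
open Subgraph public

vH : ∀ {n} {G : SimpleGraph n} → Subgraph G → ℕ
vH H = countV (verts H)

eH : ∀ {n} {G : SimpleGraph n} → Subgraph G → ℕ
eH H = countE (eadj H)

-- G balanced: e(G)/v(G) ≥ e(H)/v(H) for every nonempty subgraph H (v(G) = n),
-- written with cross-multiplication.
Balanced : ∀ {n} → SimpleGraph n → Set
Balanced {n} G = (H : Subgraph G) → 1 ≤ vH H → eH H * n ≤ edgeCount G * vH H

-- Outcome of the randomness: the sequence π₁, π₂, … (0-indexed here).
Outcome : ℕ → Set
Outcome n = ℕ → Permutation′ n

-- Vertex offered in round t+1 (t = 0,1,2,…): π_{⌈(t+1)/n⌉}((t mod n) + 1).
offered : ∀ {n} .{{_ : NonZero n}} → Outcome n → ℕ → Fin n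
offered {n} π t = π (t / n) ⟨$⟩ʳ fromℕ< (m%n<n t n)

history : ∀ {n} .{{_ : NonZero n}} → Outcome n → ℕ → List (Fin n)
history π zero    = []
history π (suc t) = history π t ++ [ offered π t ]

-- A (deterministic) strategy: choice of u_k from the history v_1,…,v_k
-- (Builder's own earlier choices are determined by these).
Strategy : ℕ → Set
Strategy n = List (Fin n) → Fin n

-- Builder's multigraph after k rounds, as the list of edges u_j v_j (multi-edges, loops allowed).
builderGraph : ∀ {n} .{{_ : NonZero n}} → Strategy n → Outcome n → ℕ → List (Fin n × Fin n)
builderGraph S π k = map (λ t → (S (history π (suc t)) , offered π t)) (upTo k)

HasEdge : ∀ {n} → List (Fin n × Fin n) → Fin n → Fin n → Set
HasEdge L i j = ((i , j) ∈ L) ⊎ ((j , i) ∈ L)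

ContainsLab : ∀ {n} → SimpleGraph n → List (Fin n × Fin n) → Set
ContainsLab G L = ∀ i j → adj G i j ≡ true → HasEdge L i j

ContainsCopy : ∀ {n} → SimpleGraph n → List (Fin n × Fin n) → Set
ContainsCopy {n} G L = Σ (Fin n → Fin n) λ σ →
  Injective _≡_ _≡_ σ × (∀ i j → adj G i j ≡ true → HasEdge L (σ i) (σ j))

ceilMul : (m n : ℕ) .{{_ : NonZero n}} → ℕ
ceilMul m n = ((m + n ∸ 1) / n) * n

-- Lower bound: the copy of G has e(G) distinct edges and every round adds a single
-- edge. Upper bound: if G is balanced and d = ⌈m/n⌉, every subgraph H has
-- e(H) ≤ m v(H)/n ≤ d v(H), so by Hakimi's theorem G has an orientation in which
-- every in-degree is at most d. Split the rounds into phases of n consecutive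
-- rounds; in each phase a fresh permutation offers every vertex exactly once, and
-- in phase r Builder joins the offered vertex to its r-th in-neighbour. After d
-- phases, i.e. ⌈m/n⌉ n rounds, every edge of G is present.
module Submission where

open import Defs hiding (sym; irrefl)
open import Data.Nat using (ℕ; _<_; NonZero)
open import Data.Nat.Divisibility using (_∣_)
open import Data.Product using (_×_; Σ)
open import Relation.Nullary using (¬_)

open import Data.Bool using (Bool; true; false; if_then_else_; _∧_; _∨_; T?)
open import Data.Bool.Properties using (∧-assoc; ∧-comm; ∨-zeroʳ; T-∧; T-≡)
open import Data.Empty using (⊥; ⊥-elim)
open import Data.Fin using (Fin; zero; suc; toℕ; fromℕ<)
open import Data.Fin.Permutation using (_⟨$⟩ʳ_; _⟨$⟩ˡ_; inverseʳ)
open import Data.Fin.Properties using (toℕ-injective; toℕ-fromℕ<; toℕ<n; _≟_)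
import Data.Fin.Properties as Fin
open import Data.Fin.Subset.Properties using (anySubset?)
open import Data.List
  using (List; []; _∷_; _++_; [_]; length; map; filterᵇ; cartesianProduct; allFin; tabulate; upTo)
open import Data.List.Membership.Propositional using (_∈_)
open import Data.List.Membership.Propositional.Properties
  using (∈-∃++; ∈-filter⁺; ∈-filter⁻; ∈-cartesianProduct⁺; ∈-allFin; ∈-map⁺; ∈-upTo⁺)
open import Data.List.Properties
  using (map-cong; map-++; map-∘; map-tabulate; length-++; length-++-sucʳ; length-map; length-upTo)
import Data.List.Relation.Unary.All as All
open import Data.List.Relation.Unary.AllPairs using ([]; _∷_)
open import Data.List.Relation.Unary.Any using (here; there)
open import Data.List.Relation.Unary.Unique.Propositional using (Unique)
import Data.List.Relation.Unary.Unique.Propositional.Properties as Unique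
open import Data.Nat using (zero; suc; _+_; _*_; _∸_; _/_; _%_; _≤_; _<ᵇ_; z≤n; s≤s; >-nonZero⁻¹)
open import Data.Nat.DivMod
  using (m%n<n; m≡m%n+[m/n]*n; +-distrib-/-∣ʳ; m<n⇒m/n≡0; m*n/n≡m; [m+kn]%n≡m%n; m<n⇒m%n≡m)
open import Data.Nat.Divisibility using (divides; n∣m*n)
open import Data.Nat.ListAction using (sum)
open import Data.Nat.ListAction.Properties using (sum-++)
open import Data.Nat.Properties hiding (_≟_)
open import Algebra.Properties.Semiring.Sum +-*-semiring
  using (sum-cong-≗; ∑-distrib-+; *-distribˡ-sum; sum-replicate-zero) renaming (sum to ∑)
open import Data.Nat.Tactic.RingSolver using (solve-∀)
open import Data.Product using (_,_; proj₁; proj₂; ∃; swap)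
open import Data.Sum using (_⊎_; inj₁; inj₂)
import Data.Sum as Sum
open import Data.Vec using (lookup) renaming (tabulate to tabulateᵛ)
open import Data.Vec.Functional using (updateAt)
open import Data.Vec.Functional.Properties using (updateAt-updates; updateAt-minimal)
open import Data.Vec.Properties using (lookup∘tabulate)
open import Function using (_∘_; Equivalence)
open import Relation.Binary.Definitions using (tri<; tri≈; tri>)
open import Relation.Binary.PropositionalEquality hiding ([_])
open import Relation.Nullary using (yes; no; does; ¬?; contradiction)
open import Relation.Nullary.Decidable using (decidable-stable)

𝟙 : Bool → ℕ
𝟙 b = if b then 1 else 0

VertexSet : ℕ → Set
VertexSet n = Fin n → Bool

module _ {n : ℕ} where

  infixr 6 _∪_
  infixr 7 _∩_

  _∪_ _∩_ : VertexSet n → VertexSet n → VertexSet n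
  (s ∪ t) i = s i ∨ t i
  (s ∩ t) i = s i ∧ t i

  ⁅_⁆ : Fin n → VertexSet n
  ⁅ w ⁆ i = does (i ≟ w)

  weight : VertexSet n → (Fin n → ℕ) → ℕ
  weight s f = ∑ λ i → if s i then f i else 0

  size : VertexSet n → ℕ
  size s = weight s (λ _ → 1)

weight-cong : ∀ {n} {s t : VertexSet n} (f : Fin n → ℕ) → s ≗ t → weight s f ≡ weight t f
weight-cong f s≗t = sum-cong-≗ (λ i → cong (λ b → if b then f i else 0) (s≗t i))

weight-∪-∩ : ∀ {n} (s t : VertexSet n) (f : Fin n → ℕ) →
  weight (s ∪ t) f + weight (s ∩ t) f ≡ weight s f + weight t f
weight-∪-∩ s t f = begin
  weight (s ∪ t) f + weight (s ∩ t) f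
    ≡⟨ ∑-distrib-+ (λ i → if s i ∨ t i then f i else 0) (λ i → if s i ∧ t i then f i else 0) ⟨
  ∑ (λ i → (if s i ∨ t i then f i else 0) + (if s i ∧ t i then f i else 0))
    ≡⟨ sum-cong-≗ (λ i → pointwise (s i) (t i) (f i)) ⟩
  ∑ (λ i → (if s i then f i else 0) + (if t i then f i else 0))
    ≡⟨ ∑-distrib-+ (λ i → if s i then f i else 0) (λ i → if t i then f i else 0) ⟩
  weight s f + weight t f ∎
  where
  open ≡-Reasoning
  pointwise : ∀ a b x → (if a ∨ b then x else 0) + (if a ∧ b then x else 0) ≡ (if a then x else 0) + (if b then x else 0)
  pointwise true  true  x = refl
  pointwise true  false x = refl
  pointwise false true  x = +-comm x 0
  pointwise false false x = refl

weight-⁅⁆ : ∀ {n} (w : Fin n) (f : Fin n → ℕ) → weight ⁅ w ⁆ f ≡ f w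
weight-⁅⁆ {suc n} zero    f = trans (cong (f zero +_) (sum-replicate-zero n)) (+-identityʳ (f zero))
weight-⁅⁆ {suc n} (suc w) f = weight-⁅⁆ w (f ∘ suc)

weight-updateAt : ∀ {n} (s : VertexSet n) (ℓ : Fin n → ℕ) (u : Fin n) →
  weight s (updateAt ℓ u suc) ≡ weight s ℓ + 𝟙 (s u)
weight-updateAt {suc n} s ℓ zero with s zero
... | true  = +-comm 1 (ℓ zero + weight (s ∘ suc) (ℓ ∘ suc))
... | false = sym (+-identityʳ _)
weight-updateAt {suc n} s ℓ (suc u) =
  trans (cong (s₀ +_) (weight-updateAt (s ∘ suc) (ℓ ∘ suc) u))
        (sym (+-assoc s₀ (weight (s ∘ suc) (ℓ ∘ suc)) (𝟙 (s (suc u)))))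
  where s₀ = if s zero then ℓ zero else 0

weight-const : ∀ {n} (s : VertexSet n) d → weight s (λ _ → d) ≡ d * size s
weight-const s d = trans (sum-cong-≗ (λ i → scale (s i))) (sym (*-distribˡ-sum d (λ i → 𝟙 (s i))))
  where
  scale : ∀ b → (if b then d else 0) ≡ d * 𝟙 b
  scale true  = sym (*-identityʳ d)
  scale false = sym (*-zeroʳ d)

size≡0⇒empty : ∀ {n} (s : VertexSet n) → size s ≡ 0 → s ≗ (λ _ → false)
size≡0⇒empty s |s|≡0 zero with s zero | |s|≡0
... | false | _ = refl
size≡0⇒empty s |s|≡0 (suc i) = size≡0⇒empty (s ∘ suc) (m+n≡0⇒n≡0 (𝟙 (s zero)) |s|≡0) i

count : ∀ {A : Set} → (A → Bool) → List A → ℕ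
count p xs = sum (map (𝟙 ∘ p) xs)

count-cong : ∀ {A : Set} {p q : A → Bool} → p ≗ q → (xs : List A) → count p xs ≡ count q xs
count-cong p≗q xs = cong sum (map-cong (cong 𝟙 ∘ p≗q) xs)

count-filterᵇ : ∀ {A : Set} (p q : A → Bool) (xs : List A) →
  count p (filterᵇ q xs) ≡ count (λ x → q x ∧ p x) xs
count-filterᵇ p q []       = refl
count-filterᵇ p q (x ∷ xs) with q x
... | true  = cong (𝟙 (p x) +_) (count-filterᵇ p q xs)
... | false = count-filterᵇ p q xs

length-filterᵇ : ∀ {A : Set} (p : A → Bool) (xs : List A) → length (filterᵇ p xs) ≡ count p xs
length-filterᵇ p []       = refl
length-filterᵇ p (x ∷ xs) with p x
... | true  = cong suc (length-filterᵇ p xs)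
... | false = length-filterᵇ p xs

sum-cartesianProduct : ∀ {A B : Set} (f : A × B → ℕ) (xs : List A) (ys : List B) →
  sum (map f (cartesianProduct xs ys)) ≡ sum (map (λ x → sum (map (λ y → f (x , y)) ys)) xs)
sum-cartesianProduct f []       ys = refl
sum-cartesianProduct f (x ∷ xs) ys = begin
  sum (map f (map (x ,_) ys ++ cartesianProduct xs ys))
    ≡⟨ cong sum (map-++ f (map (x ,_) ys) (cartesianProduct xs ys)) ⟩
  sum (map f (map (x ,_) ys) ++ map f (cartesianProduct xs ys))
    ≡⟨ sum-++ (map f (map (x ,_) ys)) (map f (cartesianProduct xs ys)) ⟩
  sum (map f (map (x ,_) ys)) + sum (map f (cartesianProduct xs ys))
    ≡⟨ cong₂ _+_ (cong sum (sym (map-∘ ys))) (sum-cartesianProduct f xs ys) ⟩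
  sum (map (λ y → f (x , y)) ys) + sum (map (λ x → sum (map (λ y → f (x , y)) ys)) xs) ∎
  where open ≡-Reasoning

sum-map-allFin : ∀ {n} (f : Fin n → ℕ) → sum (map f (allFin n)) ≡ ∑ f
sum-map-allFin f = trans (cong sum (map-tabulate (λ i → i) f)) (sum-tabulate f)
  where
  sum-tabulate : ∀ {n} (f : Fin n → ℕ) → sum (tabulate f) ≡ ∑ f
  sum-tabulate {zero}  f = refl
  sum-tabulate {suc n} f = cong (f zero +_) (sum-tabulate (f ∘ suc))

allPairs : ∀ n → List (Fin n × Fin n)
allPairs n = cartesianProduct (allFin n) (allFin n)

countE-as-count : ∀ {n} (a : Fin n → Fin n → Bool) →
  countE a ≡ count (λ (i , j) → (toℕ i <ᵇ toℕ j) ∧ a i j) (allPairs n)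
countE-as-count {n} a = sym (sum-cartesianProduct (λ (i , j) → 𝟙 ((toℕ i <ᵇ toℕ j) ∧ a i j)) (allFin n) (allFin n))

edgesIn : ∀ {n} → List (Fin n × Fin n) → VertexSet n → ℕ
edgesIn E s = count (λ (u , v) → s u ∧ s v) E

edgesIn-cong : ∀ {n} (E : List (Fin n × Fin n)) {s t : VertexSet n} → s ≗ t → edgesIn E s ≡ edgesIn E t
edgesIn-cong E s≗t = count-cong (λ (u , v) → cong₂ _∧_ (s≗t u) (s≗t v)) E

edgesIn-∅ : ∀ {n} (E : List (Fin n × Fin n)) → edgesIn E (λ _ → false) ≡ 0
edgesIn-∅ []      = refl
edgesIn-∅ (_ ∷ E) = edgesIn-∅ E

edgesIn-supermodular : ∀ {n} (E : List (Fin n × Fin n)) (s t : VertexSet n) →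
  edgesIn E s + edgesIn E t ≤ edgesIn E (s ∪ t) + edgesIn E (s ∩ t)
edgesIn-supermodular []             s t = z≤n
edgesIn-supermodular ((u , v) ∷ E) s t = begin
  (eₛ + I s) + (eₜ + I t)                   ≡⟨ +-interchange eₛ (I s) eₜ (I t) ⟩
  (eₛ + eₜ) + (I s + I t)                   ≤⟨ +-mono-≤ (pointwise (s u) (s v) (t u) (t v)) (edgesIn-supermodular E s t) ⟩
  (e∪ + e∩) + (I (s ∪ t) + I (s ∩ t))       ≡⟨ +-interchange e∪ (I (s ∪ t)) e∩ (I (s ∩ t)) ⟨
  (e∪ + I (s ∪ t)) + (e∩ + I (s ∩ t))       ∎
  where
  open ≤-Reasoning
  I = edgesIn E
  eₛ = 𝟙 (s u ∧ s v)
  eₜ = 𝟙 (t u ∧ t v)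
  e∪ = 𝟙 ((s ∪ t) u ∧ (s ∪ t) v)
  e∩ = 𝟙 ((s ∩ t) u ∧ (s ∩ t) v)
  +-interchange : ∀ a b c d → (a + b) + (c + d) ≡ (a + c) + (b + d)
  +-interchange = solve-∀
  pointwise : ∀ a b c d → 𝟙 (a ∧ b) + 𝟙 (c ∧ d) ≤ 𝟙 ((a ∨ c) ∧ (b ∨ d)) + 𝟙 ((a ∧ c) ∧ (b ∧ d))
  pointwise true  true  true  true  = ≤ᵇ⇒≤ _ _ _
  pointwise true  true  true  false = ≤ᵇ⇒≤ _ _ _
  pointwise true  true  false true  = ≤ᵇ⇒≤ _ _ _
  pointwise true  true  false false = ≤ᵇ⇒≤ _ _ _
  pointwise true  false true  true  = ≤ᵇ⇒≤ _ _ _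
  pointwise true  false true  false = ≤ᵇ⇒≤ _ _ _
  pointwise true  false false true  = ≤ᵇ⇒≤ _ _ _
  pointwise true  false false false = ≤ᵇ⇒≤ _ _ _
  pointwise false true  true  true  = ≤ᵇ⇒≤ _ _ _
  pointwise false true  true  false = ≤ᵇ⇒≤ _ _ _
  pointwise false true  false true  = ≤ᵇ⇒≤ _ _ _
  pointwise false true  false false = ≤ᵇ⇒≤ _ _ _
  pointwise false false true  true  = ≤ᵇ⇒≤ _ _ _
  pointwise false false true  false = ≤ᵇ⇒≤ _ _ _
  pointwise false false false true  = ≤ᵇ⇒≤ _ _ _
  pointwise false false false false = ≤ᵇ⇒≤ _ _ _

-- Hakimi's condition with capacities c and in-degrees ℓ already spent: e(s) + ℓ(s) ≤ c(s).
module _ {n : ℕ} where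

  FeasibleAt : (Fin n → ℕ) → List (Fin n × Fin n) → (Fin n → ℕ) → VertexSet n → Set
  FeasibleAt c E ℓ s = edgesIn E s + weight s ℓ ≤ weight s c

  Feasible : (Fin n → ℕ) → List (Fin n × Fin n) → (Fin n → ℕ) → Set
  Feasible c E ℓ = ∀ s → FeasibleAt c E ℓ s

  record Orientation (c : Fin n → ℕ) (E : List (Fin n × Fin n)) (ℓ : Fin n → ℕ) : Set where
    field
      inNbrs  : Fin n → List (Fin n)
      bounded : ∀ w → length (inNbrs w) + ℓ w ≤ c w
      covers  : ∀ {u v} → (u , v) ∈ E → u ∈ inNbrs v ⊎ v ∈ inNbrs u

open Orientation

feasible-or-violated : ∀ {n} (c : Fin n → ℕ) (E : List (Fin n × Fin n)) (ℓ : Fin n → ℕ) →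
  Feasible c E ℓ ⊎ ∃ λ s → ¬ FeasibleAt c E ℓ s
feasible-or-violated c E ℓ with anySubset? (λ S → ¬? (FeasibleAt? (lookup S)))
  where FeasibleAt? = λ s → edgesIn E s + weight s ℓ ≤? weight s c
... | yes (S , violated) = inj₂ (lookup S , violated)
... | no  noViolation    = inj₁ λ s →
  let s≗ = lookup∘tabulate s in
  subst₂ _≤_ (cong₂ _+_ (edgesIn-cong E s≗) (weight-cong ℓ s≗)) (weight-cong c s≗)
    (decidable-stable (_ ≤? _) (λ violated → noViolation (tabulateᵛ s , violated)))

-- Add the two violations: modularity of weights and supermodularity of edgesIn move them
-- to s ∪ t and s ∩ t, where s ∪ t also spans the new edge, contradicting feasibility there.
violations-clash : ∀ {n} {c ℓ : Fin n → ℕ} {E} {u v : Fin n} → Feasible c ((u , v) ∷ E) ℓ → ∀ s t →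
  ¬ FeasibleAt c E (updateAt ℓ u suc) s → ¬ FeasibleAt c E (updateAt ℓ v suc) t → ⊥
violations-clash {c = c} {ℓ} {E} {u} {v} feasible s t violatedₛ violatedₜ = 1+n≰n (begin
  1 + (1 + (C s + C t))
    ≡⟨ cong suc (+-suc (C s) (C t)) ⟨
  suc (C s) + suc (C t)
    ≤⟨ +-mono-≤ (tight s u violatedₛ) (tight t v violatedₜ) ⟩
  (I s + (L s + 𝟙 (s u))) + (I t + (L t + 𝟙 (t v)))
    ≡⟨ regroup (I s) (L s) (𝟙 (s u)) (I t) (L t) (𝟙 (t v)) ⟩
  (I s + I t) + (L s + L t) + (𝟙 (s u) + 𝟙 (t v))
    ≤⟨ +-mono-≤ (+-mono-≤ (edgesIn-supermodular E s t) (≤-reflexive (sym (weight-∪-∩ s t ℓ))))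
                (endpoints (s u) (s v) (t u) (t v)) ⟩
  (I (s ∪ t) + I (s ∩ t)) + (L (s ∪ t) + L (s ∩ t)) + (1 + e∪)
    ≡⟨ regroup′ (I (s ∪ t)) (I (s ∩ t)) (L (s ∪ t)) (L (s ∩ t)) e∪ ⟩
  1 + ((e∪ + I (s ∪ t) + L (s ∪ t)) + (I (s ∩ t) + L (s ∩ t)))
    ≤⟨ +-monoʳ-≤ 1 (+-mono-≤ (feasible (s ∪ t)) (drop-new-edge (s ∩ t))) ⟩
  1 + (C (s ∪ t) + C (s ∩ t))
    ≡⟨ cong (1 +_) (weight-∪-∩ s t c) ⟩
  1 + (C s + C t) ∎)
  where
  open ≤-Reasoning
  C L : VertexSet _ → ℕ
  C x = weight x c
  L x = weight x ℓ
  I = edgesIn E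
  e∪ = 𝟙 ((s ∪ t) u ∧ (s ∪ t) v)
  tight : ∀ x w → ¬ FeasibleAt c E (updateAt ℓ w suc) x → suc (C x) ≤ I x + (L x + 𝟙 (x w))
  tight x w violated = subst (λ y → C x < I x + y) (weight-updateAt x ℓ w) (≰⇒> violated)
  drop-new-edge : ∀ x → I x + L x ≤ C x
  drop-new-edge x = begin
    I x + L x                      ≤⟨ m≤n+m (I x + L x) (𝟙 (x u ∧ x v)) ⟩
    𝟙 (x u ∧ x v) + (I x + L x)    ≡⟨ +-assoc (𝟙 (x u ∧ x v)) (I x) (L x) ⟨
    𝟙 (x u ∧ x v) + I x + L x      ≤⟨ feasible x ⟩
    C x                            ∎
  endpoints : ∀ a b c d → 𝟙 a + 𝟙 d ≤ 1 + 𝟙 ((a ∨ c) ∧ (b ∨ d))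
  endpoints true  b c true  rewrite ∨-zeroʳ b = ≤-refl
  endpoints true  b c false = m≤m+n 1 _
  endpoints false b c true  = m≤m+n 1 _
  endpoints false b c false = z≤n
  regroup : ∀ a b c d e f → (a + (b + c)) + (d + (e + f)) ≡ (a + d) + (b + e) + (c + f)
  regroup = solve-∀
  regroup′ : ∀ a b c d e → (a + b) + (c + d) + (1 + e) ≡ 1 + ((e + a + c) + (b + d))
  regroup′ = solve-∀

feasible-step : ∀ {n} {c ℓ : Fin n → ℕ} {E} {u v : Fin n} → Feasible c ((u , v) ∷ E) ℓ →
  Feasible c E (updateAt ℓ u suc) ⊎ Feasible c E (updateAt ℓ v suc)
feasible-step {c = c} {ℓ} {E} {u} {v} feasible
  with feasible-or-violated c E (updateAt ℓ u suc) | feasible-or-violated c E (updateAt ℓ v suc)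
... | inj₁ feasibleᵤ       | _                    = inj₁ feasibleᵤ
... | inj₂ _               | inj₁ feasibleᵥ       = inj₂ feasibleᵥ
... | inj₂ (s , violatedₛ) | inj₂ (t , violatedₜ) = ⊥-elim (violations-clash {E = E} feasible s t violatedₛ violatedₜ)

orient-into : ∀ {n} {c ℓ : Fin n → ℕ} {E} (u v : Fin n) →
  Orientation c E (updateAt ℓ u suc) → Orientation c ((u , v) ∷ E) ℓ
orient-into {c = c} {ℓ} u v O = record
  { inNbrs  = inNbrs′
  ; bounded = bounded′
  ; covers  = λ { (here refl) → inj₂ (subst (v ∈_) (sym (updateAt-updates u (inNbrs O))) (here refl))
                ; (there e)   → Sum.map keep keep (covers O e) }
  }
  where
  inNbrs′ : Fin _ → List (Fin _)
  inNbrs′ = updateAt (inNbrs O) u (v ∷_)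
  keep : ∀ {x w} → x ∈ inNbrs O w → x ∈ inNbrs′ w
  keep {w = w} x∈ with w ≟ u
  ... | yes refl = subst (_ ∈_) (sym (updateAt-updates u (inNbrs O))) (there x∈)
  ... | no  w≢u  = subst (_ ∈_) (sym (updateAt-minimal w u (inNbrs O) w≢u)) x∈
  bounded′ : ∀ w → length (inNbrs′ w) + ℓ w ≤ c w
  bounded′ w with w ≟ u
  ... | yes refl = begin
    length (inNbrs′ u) + ℓ u                  ≡⟨ cong (λ xs → length xs + ℓ u) (updateAt-updates u (inNbrs O)) ⟩
    suc (length (inNbrs O u) + ℓ u)           ≡⟨ +-suc (length (inNbrs O u)) (ℓ u) ⟨
    length (inNbrs O u) + suc (ℓ u)           ≡⟨ cong (length (inNbrs O u) +_) (updateAt-updates u ℓ) ⟨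
    length (inNbrs O u) + updateAt ℓ u suc u  ≤⟨ bounded O u ⟩
    c u                                       ∎
    where open ≤-Reasoning
  ... | no  w≢u  = subst (_≤ c w)
    (cong₂ (λ xs k → length xs + k) (sym (updateAt-minimal w u (inNbrs O) w≢u)) (updateAt-minimal w u ℓ w≢u))
    (bounded O w)

orientation-swap-head : ∀ {n} {c ℓ : Fin n → ℕ} {E} {u v : Fin n} →
  Orientation c ((v , u) ∷ E) ℓ → Orientation c ((u , v) ∷ E) ℓ
orientation-swap-head O = record
  { inNbrs  = inNbrs O
  ; bounded = bounded O
  ; covers  = λ { (here refl) → Sum.swap (covers O (here refl)) ; (there e) → covers O (there e) }
  }

feasible⇒orientation : ∀ {n} {c ℓ : Fin n → ℕ} (E : List (Fin n × Fin n)) → Feasible c E ℓ → Orientation c E ℓ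
feasible⇒orientation {c = c} {ℓ} [] feasible = record
  { inNbrs  = λ _ → []
  ; bounded = λ w → subst₂ _≤_ (weight-⁅⁆ w ℓ) (weight-⁅⁆ w c) (feasible ⁅ w ⁆)
  ; covers  = λ ()
  }
feasible⇒orientation ((u , v) ∷ E) feasible with feasible-step {E = E} feasible
... | inj₁ feasibleᵤ = orient-into u v (feasible⇒orientation E feasibleᵤ)
... | inj₂ feasibleᵥ = orientation-swap-head (orient-into v u (feasible⇒orientation E feasibleᵥ))

hakimi : ∀ {n} {c : Fin n → ℕ} (E : List (Fin n × Fin n)) →
  (∀ s → edgesIn E s ≤ weight s c) → Orientation c E (λ _ → 0)
hakimi {c = c} E sparse = feasible⇒orientation E λ s → begin
  edgesIn E s + weight s (λ _ → 0) ≡⟨ cong (edgesIn E s +_) (weight-const s 0) ⟩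
  edgesIn E s + 0                  ≡⟨ +-identityʳ (edgesIn E s) ⟩
  edgesIn E s                      ≤⟨ sparse s ⟩
  weight s c                       ∎
  where open ≤-Reasoning

module _ {n : ℕ} (G : SimpleGraph n) where

  isEdge : Fin n × Fin n → Bool
  isEdge (i , j) = (toℕ i <ᵇ toℕ j) ∧ adj G i j

  edges : List (Fin n × Fin n)
  edges = filterᵇ isEdge (allPairs n)

  edges-unique : Unique edges
  edges-unique = Unique.filter⁺ (T? ∘ isEdge) (Unique.cartesianProduct⁺ (Unique.allFin⁺ n) (Unique.allFin⁺ n))

  ∈-edges⁺ : ∀ {i j} → toℕ i < toℕ j → adj G i j ≡ true → (i , j) ∈ edges
  ∈-edges⁺ {i} {j} i<j ij∈G = ∈-filter⁺ (T? ∘ isEdge) (∈-cartesianProduct⁺ (∈-allFin i) (∈-allFin j))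
    (Equivalence.from T-∧ (<⇒<ᵇ i<j , Equivalence.from T-≡ ij∈G))

  ∈-edges⁻ : ∀ {i j} → (i , j) ∈ edges → toℕ i < toℕ j × adj G i j ≡ true
  ∈-edges⁻ e with i<ᵇj , ij∈G ← Equivalence.to T-∧ (proj₂ (∈-filter⁻ (T? ∘ isEdge) {xs = allPairs n} e)) =
    <ᵇ⇒< _ _ i<ᵇj , Equivalence.to T-≡ ij∈G

  adj⇒∈-edges : ∀ {i j} → adj G i j ≡ true → (i , j) ∈ edges ⊎ (j , i) ∈ edges
  adj⇒∈-edges {i} {j} ij∈G with <-cmp (toℕ i) (toℕ j)
  ... | tri< i<j _ _ = inj₁ (∈-edges⁺ i<j ij∈G)
  ... | tri> _ _ j<i = inj₂ (∈-edges⁺ j<i (trans (SimpleGraph.sym G j i) ij∈G))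
  ... | tri≈ _ i≡j _ with toℕ-injective i≡j
  ...   | refl = contradiction (trans (sym ij∈G) (SimpleGraph.irrefl G i)) λ ()

  edgeCount≡length-edges : edgeCount G ≡ length edges
  edgeCount≡length-edges = trans (countE-as-count (adj G)) (sym (length-filterᵇ isEdge (allPairs n)))

  induced : VertexSet n → Subgraph G
  induced s = record
    { verts = s
    ; eadj  = λ i j → adj G i j ∧ (s i ∧ s j)
    ; esym  = λ i j → cong₂ _∧_ (SimpleGraph.sym G i j) (∧-comm (s i) (s j))
    ; sub   = λ i j e → proj₁ (∧-true e)
    ; endsˡ = λ i j e → proj₁ (∧-true (proj₂ (∧-true {adj G i j} e)))
    }
    where
    ∧-true : ∀ {a b} → a ∧ b ≡ true → a ≡ true × b ≡ true
    ∧-true {true} b≡true = refl , b≡true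

  vH-induced : ∀ s → vH (induced s) ≡ size s
  vH-induced s = sum-map-allFin (λ i → 𝟙 (s i))

  eH-induced : ∀ s → eH (induced s) ≡ edgesIn edges s
  eH-induced s = begin
    eH (induced s)
      ≡⟨ countE-as-count (λ i j → adj G i j ∧ (s i ∧ s j)) ⟩
    count (λ (i , j) → (toℕ i <ᵇ toℕ j) ∧ (adj G i j ∧ (s i ∧ s j))) (allPairs n)
      ≡⟨ count-cong (λ (i , j) → ∧-assoc (toℕ i <ᵇ toℕ j) (adj G i j) (s i ∧ s j)) (allPairs n) ⟨
    count (λ x → isEdge x ∧ (s (proj₁ x) ∧ s (proj₂ x))) (allPairs n)
      ≡⟨ count-filterᵇ (λ (i , j) → s i ∧ s j) isEdge (allPairs n) ⟨
    edgesIn edges s ∎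
    where open ≡-Reasoning

balanced⇒sparse : ∀ {n} .{{_ : NonZero n}} (G : SimpleGraph n) → Balanced G →
  ∀ {d} → edgeCount G ≤ d * n → ∀ s → edgesIn (edges G) s ≤ weight s (λ _ → d)
balanced⇒sparse {n} G balanced {d} m≤dn s with size s in |s|≡
... | zero  = begin
  edgesIn (edges G) s              ≡⟨ edgesIn-cong (edges G) (size≡0⇒empty s |s|≡) ⟩
  edgesIn (edges G) (λ _ → false)  ≡⟨ edgesIn-∅ (edges G) ⟩
  0                                ≤⟨ z≤n ⟩
  weight s (λ _ → d)               ∎
  where open ≤-Reasoning
... | suc k = *-cancelʳ-≤ _ _ n (begin
  edgesIn (edges G) s * n              ≡⟨ cong (_* n) (eH-induced G s) ⟨
  eH (induced G s) * n                 ≤⟨ balanced (induced G s) (subst (1 ≤_) (sym |H|≡) (s≤s z≤n)) ⟩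
  edgeCount G * vH (induced G s)       ≡⟨ cong (edgeCount G *_) |H|≡ ⟩
  edgeCount G * suc k                  ≤⟨ *-monoˡ-≤ (suc k) m≤dn ⟩
  d * n * suc k                        ≡⟨ swap-factors d n (suc k) ⟩
  d * suc k * n                        ≡⟨ cong (λ x → d * x * n) |s|≡ ⟨
  d * size s * n                       ≡⟨ cong (_* n) (weight-const s d) ⟨
  weight s (λ _ → d) * n               ∎)
  where
  open ≤-Reasoning
  |H|≡ : vH (induced G s) ≡ suc k
  |H|≡ = trans (vH-induced G s) |s|≡
  swap-factors : ∀ a b c → a * b * c ≡ a * c * b
  swap-factors = solve-∀

[p+rn]/n≡r : ∀ {n} .{{_ : NonZero n}} p r → p < n → (p + r * n) / n ≡ r
[p+rn]/n≡r {n} p r p<n = begin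
  (p + r * n) / n      ≡⟨ +-distrib-/-∣ʳ p (n∣m*n r) ⟩
  p / n + r * n / n    ≡⟨ cong₂ _+_ (m<n⇒m/n≡0 p<n) (m*n/n≡m r n) ⟩
  r                    ∎
  where open ≡-Reasoning

[p+rn]%n≡p : ∀ {n} .{{_ : NonZero n}} p r → p < n → (p + r * n) % n ≡ p
[p+rn]%n≡p {n} p r p<n = trans ([m+kn]%n≡m%n p r n) (m<n⇒m%n≡m p<n)

ceilMul-suc : ∀ m n → ceilMul m (suc n) ≡ (m + n) / suc n * suc n
ceilMul-suc m n = cong (λ a → a / suc n * suc n) (cong (_∸ 1) (+-suc m n))

m≤ceilMul : ∀ m n .{{_ : NonZero n}} → m ≤ ceilMul m n
m≤ceilMul m (suc n) = +-cancelʳ-≤ n m (ceilMul m (suc n)) (begin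
  m + n                                  ≡⟨ m≡m%n+[m/n]*n (m + n) (suc n) ⟩
  (m + n) % suc n + (m + n) / suc n * suc n ≤⟨ +-monoˡ-≤ _ (m<1+n⇒m≤n (m%n<n (m + n) (suc n))) ⟩
  n + (m + n) / suc n * suc n            ≡⟨ cong (n +_) (ceilMul-suc m n) ⟨
  n + ceilMul m (suc n)                  ≡⟨ +-comm n _ ⟩
  ceilMul m (suc n) + n                  ∎)
  where open ≤-Reasoning

ceilMul-multiple : ∀ m n .{{_ : NonZero n}} → n ∣ m → ceilMul m n ≡ m
ceilMul-multiple .(q * suc n) (suc n) (divides q refl) = begin
  ceilMul (q * suc n) (suc n)          ≡⟨ ceilMul-suc (q * suc n) n ⟩
  (q * suc n + n) / suc n * suc n      ≡⟨ cong (λ a → a / suc n * suc n) (+-comm (q * suc n) n) ⟩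
  (n + q * suc n) / suc n * suc n      ≡⟨ cong (_* suc n) ([p+rn]/n≡r n q ≤-refl) ⟩
  q * suc n                            ∎
  where open ≡-Reasoning

lastOr : ∀ {A : Set} → A → List A → A
lastOr x []       = x
lastOr x (y ∷ ys) = lastOr y ys

lastOr-∷ʳ : ∀ {A : Set} (x : A) xs y → lastOr x (xs ++ [ y ]) ≡ y
lastOr-∷ʳ x []       y = refl
lastOr-∷ʳ x (z ∷ zs) y = lastOr-∷ʳ z zs y

lookupOr : ∀ {A : Set} → A → List A → ℕ → A
lookupOr x []       _       = x
lookupOr x (y ∷ ys) zero    = y
lookupOr x (y ∷ ys) (suc r) = lookupOr x ys r

∈⇒lookupOr : ∀ {A : Set} (x : A) {y ys} → y ∈ ys → ∃ λ r → r < length ys × lookupOr x ys r ≡ y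
∈⇒lookupOr x (here refl) = 0 , s≤s z≤n , refl
∈⇒lookupOr x (there y∈)  with r , r< , eq ← ∈⇒lookupOr x y∈ = suc r , s≤s r< , eq

module _ {n : ℕ} .{{_ : NonZero n}} where

  length-history : (π : Outcome n) (t : ℕ) → length (history π t) ≡ t
  length-history π zero    = refl
  length-history π (suc t) = trans (length-++ (history π t)) (trans (+-comm _ 1) (cong suc (length-history π t)))

  -- Rounds count from 0, as in `offered`: phase r consists of the rounds r n, …, r n + n - 1.
  roundOf : Outcome n → ℕ → Fin n → ℕ
  roundOf π r b = toℕ (π r ⟨$⟩ˡ b) + r * n

  roundOf-phase : ∀ π r b → roundOf π r b / n ≡ r
  roundOf-phase π r b = [p+rn]/n≡r _ r (toℕ<n (π r ⟨$⟩ˡ b))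

  offered-roundOf : ∀ π r b → offered π (roundOf π r b) ≡ b
  offered-roundOf π r b = begin
    π (t / n) ⟨$⟩ʳ fromℕ< (m%n<n t n)   ≡⟨ cong₂ (λ k i → π k ⟨$⟩ʳ i) (roundOf-phase π r b) slot ⟩
    π r ⟨$⟩ʳ (π r ⟨$⟩ˡ b)               ≡⟨ inverseʳ (π r) ⟩
    b                                   ∎
    where
    open ≡-Reasoning
    t = roundOf π r b
    slot : fromℕ< (m%n<n t n) ≡ π r ⟨$⟩ˡ b
    slot = toℕ-injective (trans (toℕ-fromℕ< _) ([p+rn]%n≡p _ r (toℕ<n (π r ⟨$⟩ˡ b))))

  roundOf-< : ∀ π {r d} b → r < d → roundOf π r b < d * n
  roundOf-< π {r} {d} b r<d = begin-strict
    toℕ (π r ⟨$⟩ˡ b) + r * n   <⟨ +-monoˡ-< (r * n) (toℕ<n (π r ⟨$⟩ˡ b)) ⟩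
    n + r * n                 ≤⟨ *-monoˡ-≤ n r<d ⟩
    d * n                     ∎
    where open ≤-Reasoning

  -- In phase r Builder joins the offered vertex b to its r-th in-neighbour (to b itself if there is none).
  phaseStrategy : (Fin n → List (Fin n)) → Strategy n
  phaseStrategy inNbrs h = lookupOr b (inNbrs b) ((length h ∸ 1) / n)
    where b = lastOr (fromℕ< (>-nonZero⁻¹ n)) h

  phaseStrategy-adds : (inNbrs : Fin n → List (Fin n)) (π : Outcome n) {d : ℕ} →
    (∀ b → length (inNbrs b) ≤ d) → ∀ {a b} → a ∈ inNbrs b → (a , b) ∈ builderGraph (phaseStrategy inNbrs) π (d * n)
  phaseStrategy-adds inNbrs π bounded {a} {b} a∈
    with r , r< , lookup≡a ← ∈⇒lookupOr b a∈ =
    subst (_∈ builderGraph (phaseStrategy inNbrs) π _) (cong₂ _,_ chooses-a (offered-roundOf π r b))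
      (∈-map⁺ (λ t → phaseStrategy inNbrs (history π (suc t)) , offered π t)
        (∈-upTo⁺ (roundOf-< π b (≤-trans r< (bounded b)))))
    where
    t = roundOf π r b
    chooses-a : phaseStrategy inNbrs (history π (suc t)) ≡ a
    chooses-a = begin
      lookupOr _ (inNbrs _) ((length (history π (suc t)) ∸ 1) / n)
        ≡⟨ cong₂ (λ v k → lookupOr v (inNbrs v) k)
             (trans (lastOr-∷ʳ _ (history π t) (offered π t)) (offered-roundOf π r b))
             (trans (cong (λ k → (k ∸ 1) / n) (length-history π (suc t))) (roundOf-phase π r b)) ⟩
      lookupOr b (inNbrs b) r
        ≡⟨ lookup≡a ⟩
      a ∎
      where open ≡-Reasoning

∈-++-∷⇒∈-++ : ∀ {A : Set} {x y : A} (ys₁ : List A) {ys₂} → y ∈ ys₁ ++ x ∷ ys₂ → y ≢ x → y ∈ ys₁ ++ ys₂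
∈-++-∷⇒∈-++ []        (here y≡x) y≢x = contradiction y≡x y≢x
∈-++-∷⇒∈-++ []        (there y∈) _   = y∈
∈-++-∷⇒∈-++ (_ ∷ ys₁) (here refl) _  = here refl
∈-++-∷⇒∈-++ (_ ∷ ys₁) (there y∈) y≢x = there (∈-++-∷⇒∈-++ ys₁ y∈ y≢x)

length-≤-by-injection : ∀ {A B : Set} (f : A → B) {xs : List A} {ys : List B} → Unique xs →
  (∀ {x} → x ∈ xs → f x ∈ ys) → (∀ {x y} → x ∈ xs → y ∈ xs → f x ≡ f y → x ≡ y) →
  length xs ≤ length ys
length-≤-by-injection f []                        into inj = z≤n
length-≤-by-injection f {x ∷ xs} (x≢xs ∷ unique) into inj
  with ys₁ , ys₂ , refl ← ∈-∃++ (into (here refl)) =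
  subst (suc (length xs) ≤_) (sym (length-++-sucʳ ys₁ (f x) ys₂))
    (s≤s (length-≤-by-injection f unique into′ λ y∈ z∈ → inj (there y∈) (there z∈)))
  where
  into′ : ∀ {y} → y ∈ xs → f y ∈ ys₁ ++ ys₂
  into′ y∈ = ∈-++-∷⇒∈-++ ys₁ (into (there y∈)) λ fy≡fx → All.lookup x≢xs y∈ (inj (here refl) (there y∈) (sym fy≡fx))

module _ {n : ℕ} where

  unorder : Fin n × Fin n → Fin n × Fin n
  unorder (a , b) with a Fin.≤? b
  ... | yes _ = (a , b)
  ... | no  _ = (b , a)

  unorder-swap : ∀ a b → unorder (b , a) ≡ unorder (a , b)
  unorder-swap a b with a Fin.≤? b | b Fin.≤? a
  ... | yes a≤b | yes b≤a = cong₂ _,_ (sym a≡b) a≡b where a≡b = toℕ-injective (≤-antisym a≤b b≤a)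
  ... | yes _   | no  _   = refl
  ... | no  _   | yes _   = refl
  ... | no  a≰b | no  b≰a = contradiction (≤-total (toℕ a) (toℕ b)) (Sum.[ a≰b , b≰a ])

  unorder-injective : ∀ p q → unorder p ≡ unorder q → p ≡ q ⊎ p ≡ swap q
  unorder-injective (a , b) (c , d) eq with a Fin.≤? b | c Fin.≤? d
  ... | yes _ | yes _ = inj₁ eq
  ... | yes _ | no  _ = inj₂ eq
  ... | no  _ | yes _ = inj₂ (cong swap eq)
  ... | no  _ | no  _ = inj₁ (cong swap eq)

copy⇒edgeCount≤length : ∀ {n} (G : SimpleGraph n) (L : List (Fin n × Fin n)) →
  ContainsCopy G L → edgeCount G ≤ length L
copy⇒edgeCount≤length {n} G L (σ , σ-injective , σ-embeds) = begin
  edgeCount G               ≡⟨ edgeCount≡length-edges G ⟩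
  length (edges G)          ≤⟨ length-≤-by-injection image (edges-unique G) image∈ image-injective ⟩
  length (map unorder L)    ≡⟨ length-map unorder L ⟩
  length L                  ∎
  where
  open ≤-Reasoning
  image : Fin n × Fin n → Fin n × Fin n
  image (i , j) = unorder (σ i , σ j)
  image∈ : ∀ {e} → e ∈ edges G → image e ∈ map unorder L
  image∈ {i , j} e∈ with σ-embeds i j (proj₂ (∈-edges⁻ G e∈))
  ... | inj₁ σe∈L = ∈-map⁺ unorder σe∈L
  ... | inj₂ σe∈L = subst (_∈ map unorder L) (unorder-swap (σ i) (σ j)) (∈-map⁺ unorder σe∈L)
  -- A swapped match would put i < j and j < i at once.
  image-injective : ∀ {e e′} → e ∈ edges G → e′ ∈ edges G → image e ≡ image e′ → e ≡ e′
  image-injective {i , j} {i′ , j′} e∈ e′∈ eq with unorder-injective (σ i , σ j) (σ i′ , σ j′) eq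
  ... | inj₁ same    = cong₂ _,_ (σ-injective (cong proj₁ same)) (σ-injective (cong proj₂ same))
  ... | inj₂ swapped with σ-injective (cong proj₁ swapped) | σ-injective (cong proj₂ swapped)
  ...   | refl | refl = contradiction (proj₁ (∈-edges⁻ G e′∈)) (<⇒≯ (proj₁ (∈-edges⁻ G e∈)))

lower-bound : ∀ {n} .{{_ : NonZero n}} (G : SimpleGraph n) (S : Strategy n) (π : Outcome n) k →
  k < edgeCount G → ¬ ContainsCopy G (builderGraph S π k)
lower-bound G S π k k<m copy = <⇒≱ k<m (begin
  edgeCount G                 ≤⟨ copy⇒edgeCount≤length G _ copy ⟩
  length (builderGraph S π k) ≡⟨ length-map _ (upTo k) ⟩
  length (upTo k)             ≡⟨ length-upTo k ⟩
  k                           ∎)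
  where open ≤-Reasoning

lab⇒copy : ∀ {n} (G : SimpleGraph n) (L : List (Fin n × Fin n)) → ContainsLab G L → ContainsCopy G L
lab⇒copy G L lab = (λ i → i) , (λ eq → eq) , lab

covers-edges⇒lab : ∀ {n} (G : SimpleGraph n) (L : List (Fin n × Fin n)) →
  (∀ {u v} → (u , v) ∈ edges G → HasEdge L u v) → ContainsLab G L
covers-edges⇒lab G L covers i j ij∈G with adj⇒∈-edges G ij∈G
... | inj₁ e∈ = covers e∈
... | inj₂ e∈ = Sum.swap (covers e∈)

upper-bound : ∀ {n} .{{_ : NonZero n}} (G : SimpleGraph n) → Balanced G →
  Σ (Strategy n) λ S → (π : Outcome n) → ContainsLab G (builderGraph S π (ceilMul (edgeCount G) n))
upper-bound {n} G balanced = phaseStrategy (inNbrs O) , λ π →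
  covers-edges⇒lab G _ λ e∈ → Sum.map (adds π) (adds π) (covers O e∈)
  where
  d = (edgeCount G + n ∸ 1) / n
  O : Orientation (λ _ → d) (edges G) (λ _ → 0)
  O = hakimi (edges G) (balanced⇒sparse G balanced (m≤ceilMul (edgeCount G) n))
  adds : ∀ π {a b} → a ∈ inNbrs O b → (a , b) ∈ builderGraph (phaseStrategy (inNbrs O)) π (d * n)
  adds π = phaseStrategy-adds (inNbrs O) π (λ b → subst (_≤ d) (+-identityʳ _) (bounded O b))

corollary3p6 : ∀ {n} .{{_ : NonZero n}} (G : SimpleGraph n) → Balanced G →
    ((S : Strategy n) (π : Outcome n) (k : ℕ) → k < edgeCount G →
        ¬ ContainsCopy G (builderGraph S π k))
    × ((S : Strategy n) (π : Outcome n) (k : ℕ) →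
        ContainsLab G (builderGraph S π k) → ContainsCopy G (builderGraph S π k))
    × Σ (Strategy n) (λ S → (π : Outcome n) →
        ContainsLab G (builderGraph S π (ceilMul (edgeCount G) n)))
    × (n ∣ edgeCount G → Σ (Strategy n) (λ S → (π : Outcome n) →
        ContainsLab G (builderGraph S π (edgeCount G))))
corollary3p6 {n} G balanced =
  lower-bound G ,
  (λ S π k → lab⇒copy G _) ,
  upper-bound G balanced ,
  λ n∣m → let S , builds = upper-bound G balanced in
    S , λ π → subst (ContainsLab G ∘ builderGraph S π) (ceilMul-multiple (edgeCount G) n n∣m) (builds π)
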